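{- Let $\Gamma$ be a free numerical semigroup with respect to the arrangement $(r_0,\ldots,r_h)$ of its minimal generators, with $h\ge 1$. For $k\in\{1,\ldots,h+1\}$ let $d_k=\gcd(r_0,\ldots,r_{k-1})$, and for $k\in\{1,\ldots,h\}$ let $e_k=d_k/d_{k+1}$. Then: (1) $\gcd(d_h,r_h)=1$; (2) $d_h$ divides $\mathrm F(\Gamma)+r_h$ (consequently $d_h$ does not divide $\mathrm F(\Gamma)$); (3) $e_kr_k\in\langle r_0,\ldots,r_{k-1}\rangle$ for all $k=1,\ldots,h$; in particular $e_k\ge 2$; (4) $d_1>d_2>\cdots>d_{h+1}=1$; (5) $d_h\le \frac{\mathrm c(\Gamma)}{r_h-1}+1$; (6) $(d_h-1)(r_h-1)\ge 2^h$.
   Context: A numerical semigroup is a submonoid $\Gamma$ of $(\mathbb N,+)$ with finite complement in $\mathbb N$; $\mathrm F(\Gamma)$ is the largest integer not in $\Gamma$ (with $\mathrm F(\mathbb N)=-1$) and $\mathrm c(\Gamma)=\mathrm F(\Gamma)+1$. $\langle X\rangle$ denotes the submonoid of $\mathbb N$ generated by $X$. Let $\Gamma$ have minimal generating set $\{r_0,\ldots,r_h\}$ listed in a fixed order. Set $d_k=\gcd(r_0,\ldots,r_{k-1})$ for $k=1,\ldots,h+1$ and $\Gamma_k=\langle r_0/d_{k+1},\ldots,r_k/d_{k+1}\rangle$ for $k=0,\ldots,h$ (so $\Gamma_h=\Gamma$ and $\Gamma_{h-1}$ is a numerical semigroup minimally generated by $(r_0/d_h,\ldots,r_{h-1}/d_h)$).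 Gluing: if $A$ is the minimal generating set of a numerical semigroup and $A=A_1\cup A_2$ is a nontrivial partition with $a_i=\gcd(A_i)$, then $A$ is the gluing of $A_1$ and $A_2$ (and $\langle A\rangle$ the gluing of $\langle A_1/a_1\rangle$ and $\langle A_2/a_2\rangle$) if $\mathrm{lcm}(a_1,a_2)\in\langle A_1\rangle\cap\langle A_2\rangle$. $\Gamma$ is free for the arrangement $(r_0,\ldots,r_h)$ if either $h=0$ (so $r_0=1$) or $\{r_0,\ldots,r_h\}$ is the gluing of $\{r_0,\ldots,r_{h-1}\}$ and $\{r_h\}$ and $\Gamma_{h-1}$ is free for the arrangement $(r_0/d_h,\ldots,r_{h-1}/d_h)$. -}

module Defs where

open import Data.Nat using (ℕ; zero; suc; _+_; _*_; _≤_; _<_)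
open import Data.Nat.DivMod using (_/_)
open import Data.Nat.GCD using (gcd)
open import Data.Nat.LCM using (lcm)
open import Data.Product using (Σ; ∃; _×_)
open import Relation.Binary.PropositionalEquality using (_≡_)
open import Relation.Nullary using (¬_)
open import Data.Integer as ℤ using (ℤ)

-- An arrangement (r₀,…,r_{k-1}) of k naturals is a function r : ℕ → ℕ,
-- of which only the values r 0 … r (k-1) are used.

Σ< : ℕ → (ℕ → ℕ) → ℕ
Σ< zero f = 0
Σ< (suc k) f = Σ< k f + f k

Gen : ℕ → (ℕ → ℕ) → ℕ → Set
Gen k r n = ∃ λ (c : ℕ → ℕ) → Σ< k (λ i → c i * r i) ≡ n

GenExcept : ℕ → (ℕ → ℕ) → ℕ → ℕ → Set
GenExcept k r i n = ∃ λ (c : ℕ → ℕ) → (c i ≡ 0) × (Σ< k (λ j → c j * r j) ≡ n)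

IsNumSemigroup : ℕ → (ℕ → ℕ) → Set
IsNumSemigroup k r = ∃ λ N → ∀ n → N ≤ n → Gen k r n

-- {r₀,…,r_{k-1}} is the minimal generating set of a numerical semigroup
-- (no generator lies in the monoid generated by the others; this also
--  excludes repetitions and zero).
MinGenNS : ℕ → (ℕ → ℕ) → Set
MinGenNS k r = IsNumSemigroup k r × (∀ i → i < k → ¬ GenExcept k r i (r i))

-- d r k = gcd(r₀,…,r_{k-1})   (gcd of the empty family is 0)
d : (ℕ → ℕ) → ℕ → ℕ
d r zero = 0
d r (suc k) = gcd (d r k) (r k)

-- truncated division m / n (n ≠ 0 in all uses)
divBy : ℕ → ℕ → ℕ
divBy m zero = 0
divBy m (suc n) = m / suc n

Free : ℕ → (ℕ → ℕ) → Set
Free zero r = MinGenNS 1 r × (r 0 ≡ 1)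
Free (suc h) r =
  MinGenNS (suc (suc h)) r
  -- gluing of {r₀,…,r_h} and {r_{h+1}}: lcm(a₁,a₂) ∈ ⟨A₁⟩ ∩ ⟨A₂⟩
  × (Gen (suc h) r (lcm (d r (suc h)) (r (suc h)))
     × Gen 1 (λ _ → r (suc h)) (lcm (d r (suc h)) (r (suc h))))
  × Free h (λ i → divBy (r i) (d r (suc h)))

GenZ : ℕ → (ℕ → ℕ) → ℤ → Set
GenZ k r z = ∃ λ n → (z ≡ ℤ.+ n) × Gen k r n

IsFrobenius : ℕ → (ℕ → ℕ) → ℤ → Set
IsFrobenius k r F = ¬ GenZ k r F × (∀ z → F ℤ.< z → GenZ k r z)

-- Everything comes from the last gluing Γ = d_h·Γ_{h−1} + ⟨r_h⟩ (with induction on h for the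
-- statements about all k): gcd(d_h, r_h) = 1 because Γ is numerical, d_h r_h ∈ ⟨r₀,…,r_{h−1}⟩
-- by freeness, and minimality of the generators rules out e_k = 1. Write an element of Γ as
-- s + c·r_h with d_h ∣ s. For F + r_h a coefficient c ≥ 1 would put F in Γ, giving (2); for
-- d_h r_h − d_h − r_h it would force d_h ∣ c + 1, which is too large, giving (5). For (6), every
-- generator is at least 2^h, because r_h ∈ Γ_{h−1} is neither 0 nor a generator of Γ_{h−1}.
module Submission where

open import Defs
open import Data.Nat using (ℕ; zero; suc; _+_; _*_; _∸_; _^_; _≤_; _<_; z≤n; s≤s; _<?_; ≢-nonZero)
open import Data.Nat.Properties
open import Data.Nat.Divisibility
open import Data.Nat.DivMod using (_/_; n/1≡n; m/n*n≡m; m*[n/m]≡n; m*n/m*o≡n/o)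
open import Data.Nat.GCD using (gcd; gcd[m,n]∣m; gcd[m,n]∣n; gcd-greatest; c*gcd[m,n]≡gcd[cm,cn])
open import Data.Nat.LCM using (lcm; gcd*lcm)
open import Data.Nat.Coprimality using (gcd≡1⇒coprime; coprime-divisor)
open import Data.Nat.Tactic.RingSolver using (solve-∀)
open import Data.Integer as ℤ using (ℤ)
import Data.Integer.Properties as ℤP
open import Data.Integer.Divisibility as ℤD using ()
import Data.Integer.Divisibility.Signed as ℤS
import Data.Integer.Tactic.RingSolver as ℤR
open import Algebra.Properties.CommutativeSemigroup *-commutativeSemigroup using (x∙yz≈y∙xz)
open import Algebra.Properties.AbelianGroup ℤP.+-0-abelianGroup using (∙-cancelʳ)
open import Data.Product using (_×_; _,_; proj₁; proj₂; ∃; ∃₂)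
open import Data.Sum using (_⊎_; inj₁; inj₂)
open import Data.Empty using (⊥-elim)
open import Function using (_∘_; case_of_)
open import Relation.Binary.PropositionalEquality
open import Relation.Nullary using (¬_; yes; no)

Σ<-cong : ∀ k {f g : ℕ → ℕ} → (∀ i → i < k → f i ≡ g i) → Σ< k f ≡ Σ< k g
Σ<-cong zero    f≡g = refl
Σ<-cong (suc k) f≡g = cong₂ _+_ (Σ<-cong k (λ i i<k → f≡g i (m<n⇒m<1+n i<k))) (f≡g k (n<1+n k))

Σ<-zero : ∀ k → Σ< k (λ _ → 0) ≡ 0
Σ<-zero zero    = refl
Σ<-zero (suc k) = cong (_+ 0) (Σ<-zero k)

Σ<-vanishing : ∀ {k m} (f : ℕ → ℕ) → (∀ i → k ≤ i → f i ≡ 0) → k ≤ m → Σ< m f ≡ Σ< k f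
Σ<-vanishing {m = zero}  f f≡0 z≤n = refl
Σ<-vanishing {m = suc m} f f≡0 k≤1+m with m≤n⇒m<n∨m≡n k≤1+m
... | inj₂ refl      = refl
... | inj₁ (s≤s k≤m) =
  trans (cong₂ _+_ (Σ<-vanishing f f≡0 k≤m) (f≡0 m k≤m)) (+-identityʳ _)

Σ<-*-distribˡ : ∀ k D (f : ℕ → ℕ) → Σ< k (λ i → D * f i) ≡ D * Σ< k f
Σ<-*-distribˡ zero    D f = sym (*-zeroʳ D)
Σ<-*-distribˡ (suc k) D f =
  trans (cong (_+ D * f k) (Σ<-*-distribˡ k D f)) (sym (*-distribˡ-+ D (Σ< k f) (f k)))

Σ<-rescale : ∀ k {r x : ℕ → ℕ} D (c : ℕ → ℕ) → (∀ i → i < k → r i ≡ D * x i) →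
             Σ< k (λ i → c i * r i) ≡ D * Σ< k (λ i → c i * x i)
Σ<-rescale k {r} {x} D c r≡D*x = trans (Σ<-cong k pointwise) (Σ<-*-distribˡ k D (λ i → c i * x i))
  where
  pointwise : ∀ i → i < k → c i * r i ≡ D * (c i * x i)
  pointwise i i<k = trans (cong (c i *_) (r≡D*x i i<k)) (x∙yz≈y∙xz (c i) D (x i))

Σ<-∣ : ∀ k {D} (c x : ℕ → ℕ) → (∀ i → i < k → D ∣ x i) → D ∣ Σ< k (λ i → c i * x i)
Σ<-∣ zero    c x D∣x = _ ∣0
Σ<-∣ (suc k) c x D∣x =
  ∣m∣n⇒∣m+n (Σ<-∣ k c x (λ i i<k → D∣x i (m<n⇒m<1+n i<k))) (∣n⇒∣m*n (c k) (D∣x k (n<1+n k)))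

extend : ℕ → (ℕ → ℕ) → ℕ → ℕ → ℕ
extend k c v i with i <? k
... | yes _ = c i
... | no  _ = v

extend-< : ∀ {k} c v {i} → i < k → extend k c v i ≡ c i
extend-< {k} c v {i} i<k with i <? k
... | yes _   = refl
... | no  i≮k = ⊥-elim (i≮k i<k)

extend-≥ : ∀ {k} c v {i} → k ≤ i → extend k c v i ≡ v
extend-≥ {k} c v {i} k≤i with i <? k
... | yes i<k = ⊥-elim (<⇒≱ i<k k≤i)
... | no  _   = refl

Gen-suc⁻ : ∀ {k r n} → Gen (suc k) r n → ∃₂ λ s v → Gen k r s × s + v * r k ≡ n
Gen-suc⁻ (c , eq) = _ , c _ , (c , refl) , eq

Gen-suc⁺ : ∀ {k r s} v → Gen k r s → Gen (suc k) r (s + v * r k)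
Gen-suc⁺ {k} {r} v (c , eq) =
  extend k c v ,
  cong₂ _+_ (trans (Σ<-cong k (λ i i<k → cong (_* r i) (extend-< c v i<k))) eq)
            (cong (_* r k) (extend-≥ {k} c v ≤-refl))

Gen⇒GenExcept : ∀ {k m r n} → Gen k r n → k < m → GenExcept m r k n
Gen⇒GenExcept {k} {m} {r} (c , eq) k<m =
  extend k c 0 , extend-≥ {k} c 0 ≤-refl ,
  (begin
    Σ< m (λ i → extend k c 0 i * r i)
      ≡⟨ Σ<-vanishing (λ i → extend k c 0 i * r i)
                      (λ i k≤i → cong (_* r i) (extend-≥ c 0 k≤i)) (<⇒≤ k<m) ⟩
    Σ< k (λ i → extend k c 0 i * r i)
      ≡⟨ Σ<-cong k (λ i i<k → cong (_* r i) (extend-< c 0 i<k)) ⟩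
    Σ< k (λ i → c i * r i)
      ≡⟨ eq ⟩
    _ ∎)
  where open ≡-Reasoning

GenExcept-last : ∀ {k r j} v → j < k → GenExcept (suc k) r j (v * r k)
GenExcept-last {k} {r} v j<k =
  extend k (λ _ → 0) v , extend-< (λ _ → 0) v j<k ,
  cong₂ _+_ (trans (Σ<-cong k (λ i i<k → cong (_* r i) (extend-< (λ _ → 0) v i<k))) (Σ<-zero k))
            (cong (_* r k) (extend-≥ {k} (λ _ → 0) v ≤-refl))

d∣r : ∀ k r {i} → i < k → d r k ∣ r i
d∣r (suc k) r {i} i<1+k with m<1+n⇒m<n∨m≡n i<1+k
... | inj₁ i<k  = ∣-trans (gcd[m,n]∣m (d r k) (r k)) (d∣r k r i<k)
... | inj₂ refl = gcd[m,n]∣n (d r k) (r k)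

Gen⇒d∣ : ∀ {k r n} → Gen k r n → d r k ∣ n
Gen⇒d∣ {k} {r} (c , eq) = subst (d r k ∣_) eq (Σ<-∣ k c r (λ i → d∣r k r))

IsNumSemigroup⇒d≡1 : ∀ {k r} → IsNumSemigroup k r → d r k ≡ 1
IsNumSemigroup⇒d≡1 {k} {r} (N , gen) =
  ∣1⇒≡1 (∣m+n∣m⇒∣n (subst (d r k ∣_) (+-comm 1 N) (Gen⇒d∣ {k} {r} (gen (suc N) (n≤1+n N))))
                   (Gen⇒d∣ {k} {r} (gen N ≤-refl)))

d-rescale : ∀ k {r x : ℕ → ℕ} D → (∀ i → i < k → r i ≡ D * x i) → d r k ≡ D * d x k
d-rescale zero    D r≡D*x = sym (*-zeroʳ D)
d-rescale (suc k) {r} {x} D r≡D*x =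
  trans (cong₂ gcd (d-rescale k D (λ i i<k → r≡D*x i (m<n⇒m<1+n i<k))) (r≡D*x k (n<1+n k)))
        (sym (c*gcd[m,n]≡gcd[cm,cn] D (d x k) (x k)))

Gen-rescale : ∀ {k r x n} D → (∀ i → i < k → r i ≡ D * x i) → Gen k x n → Gen k r (D * n)
Gen-rescale {k} D r≡D*x (c , eq) = c , trans (Σ<-rescale k D c r≡D*x) (cong (D *_) eq)

Gen-rescale⁻ : ∀ {k r x n} D → D ≢ 0 → (∀ i → i < k → r i ≡ D * x i) → Gen k r (D * n) → Gen k x n
Gen-rescale⁻ {k} {n = n} D D≢0 r≡D*x (c , eq) =
  c , *-cancelˡ-≡ _ n D {{≢-nonZero D≢0}} (trans (sym (Σ<-rescale k D c r≡D*x)) eq)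

d≢0 : ∀ {k r} → r 0 ≢ 0 → 0 < k → d r k ≢ 0
d≢0 {k} {r} r₀≢0 0<k d≡0 = r₀≢0 (0∣⇒≡0 (subst (_∣ r 0) d≡0 (d∣r k r 0<k)))

∣⇒≡*divBy : ∀ {D x} → D ≢ 0 → D ∣ x → x ≡ D * divBy x D
∣⇒≡*divBy {zero}  D≢0 _   = ⊥-elim (D≢0 refl)
∣⇒≡*divBy {suc D} _   D∣x = sym (m*[n/m]≡n D∣x)

divBy-cancelˡ : ∀ {D} a b → D ≢ 0 → divBy (D * a) (D * b) ≡ divBy a b
divBy-cancelˡ {zero}  a b       D≢0 = ⊥-elim (D≢0 refl)
divBy-cancelˡ {suc D} a zero    _   = cong (divBy _) (*-zeroʳ D)
divBy-cancelˡ {suc D} a (suc b) _   = m*n/m*o≡n/o (suc D) a (suc b)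

divBy≢1⇒2≤divBy×< : ∀ {a b} → b ∣ a → a ≢ 0 → divBy a b ≢ 1 → 2 ≤ divBy a b × b < a
divBy≢1⇒2≤divBy×< {a} {zero}  0∣a a≢0 _ = ⊥-elim (a≢0 (0∣⇒≡0 0∣a))
divBy≢1⇒2≤divBy×< {a} {suc b} b∣a a≢0 q≢1 with a / suc b | m/n*n≡m {a} {suc b} b∣a
... | zero          | 0≡a = ⊥-elim (a≢0 (sym 0≡a))
... | suc zero      | _   = ⊥-elim (q≢1 refl)
... | suc (suc q-2) | q*b≡a =
  s≤s (s≤s z≤n) ,
  subst (suc b <_) (trans (*-comm (suc b) _) q*b≡a) (m<m*n (suc b) (suc (suc q-2)) (s≤s (s≤s z≤n)))

MinGenNS⇒r≢0 : ∀ {m r i} → MinGenNS m r → i < m → r i ≢ 0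
MinGenNS⇒r≢0 {m} (_ , minimal) i<m rᵢ≡0 =
  minimal _ i<m ((λ _ → 0) , refl , trans (Σ<-zero m) (sym rᵢ≡0))

MinGenNS⇒r∉Gen : ∀ {m r k} → MinGenNS m r → k < m → ¬ Gen k r (r k)
MinGenNS⇒r∉Gen (_ , minimal) k<m rₖ∈ = minimal _ k<m (Gen⇒GenExcept rₖ∈ k<m)

MinGenNS⇒r≢*last : ∀ {k r j} v → MinGenNS (suc k) r → j < k → r j ≢ v * r k
MinGenNS⇒r≢*last v (_ , minimal) j<k rⱼ≡v*rₖ =
  minimal _ (m<n⇒m<1+n j<k) (subst (GenExcept _ _ _) (sym rⱼ≡v*rₖ) (GenExcept-last v j<k))

Gen-<2*min : ∀ {k x n m} → (∀ i → i < k → m ≤ x i) → Gen k x n → n < 2 * m →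
             n ≡ 0 ⊎ ∃ λ j → j < k × n ≡ x j
Gen-<2*min {zero} _ (c , refl) _ = inj₁ refl
Gen-<2*min {suc k} {x} {m = m} m≤x g n<2m with Gen-suc⁻ g
... | s , zero , gs , refl with Gen-<2*min (λ i i<k → m≤x i (m<n⇒m<1+n i<k)) gs
                                          (subst (_< 2 * m) (+-identityʳ s) n<2m)
...   | inj₁ s≡0              = inj₁ (trans (+-identityʳ s) s≡0)
...   | inj₂ (j , j<k , s≡xⱼ) = inj₂ (j , m<n⇒m<1+n j<k , trans (+-identityʳ s) s≡xⱼ)
Gen-<2*min {suc k} {x} {m = m} m≤x g n<2m | s , suc zero , gs , refl
  with Gen-<2*min (λ i i<k → m≤x i (m<n⇒m<1+n i<k)) gs (≤-<-trans (m≤m+n s _) n<2m)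
... | inj₁ refl = inj₂ (k , n<1+n k , +-identityʳ (x k))
... | inj₂ (j , j<k , refl) =
  ⊥-elim (<⇒≱ n<2m (+-mono-≤ (m≤x j (m<n⇒m<1+n j<k)) (+-monoˡ-≤ 0 (m≤x k (n<1+n k)))))
Gen-<2*min {suc k} {x} {m = m} m≤x g n<2m | s , suc (suc v) , gs , refl =
  ⊥-elim (<⇒≱ n<2m (≤-trans (+-mono-≤ m≤xₖ (+-mono-≤ m≤xₖ z≤n)) (m≤n+m _ s)))
  where
  m≤xₖ : m ≤ x k
  m≤xₖ = m≤x k (n<1+n k)

gap≤Frobenius : ∀ {k r F n} → IsFrobenius k r F → ¬ Gen k r n → ℤ.+ n ℤ.≤ F
gap≤Frobenius {k} {r} {n = n} (_ , above) n∉ = ℤP.≮⇒≥ λ F<n → n∉-ℤ (above (ℤ.+ n) F<n)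
  where
  n∉-ℤ : ¬ GenZ k r (ℤ.+ n)
  n∉-ℤ (_ , refl , n∈) = n∉ n∈

Frobenius+r∈prefix : ∀ {k r F} → r k ≢ 0 → IsFrobenius (suc k) r F →
                     ∃ λ s → F ℤ.+ ℤ.+ r k ≡ ℤ.+ s × Gen k r s
Frobenius+r∈prefix {k} {r} {F} rₖ≢0 (F∉ , above) with above (F ℤ.+ ℤ.+ r k) F<F+rₖ
  where
  F<F+rₖ : F ℤ.< F ℤ.+ ℤ.+ r k
  F<F+rₖ = subst (ℤ._< F ℤ.+ ℤ.+ r k) (ℤP.+-identityʳ F) (ℤP.+-monoʳ-< F (ℤ.+<+ (n≢0⇒n>0 rₖ≢0)))
... | n , F+rₖ≡n , n∈ with Gen-suc⁻ {k} {r} n∈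
...   | s , zero    , s∈ , refl = s , trans F+rₖ≡n (cong ℤ.+_ (+-identityʳ s)) , s∈
...   | s , suc v , s∈ , refl = ⊥-elim (F∉ (s + v * r k , F≡ , Gen-suc⁺ v s∈))
  where
  regroup : ∀ a b c → a + (b + c) ≡ (a + c) + b
  regroup = solve-∀
  F≡ : F ≡ ℤ.+ (s + v * r k)
  F≡ = ∙-cancelʳ (ℤ.+ r k) F (ℤ.+ (s + v * r k))
         (trans F+rₖ≡n (trans (cong ℤ.+_ (regroup s (r k) (v * r k))) (ℤP.pos-+ (s + v * r k) (r k))))

gluing-gap : ∀ {k r n} → gcd (d r k) (r k) ≡ 1 → 0 < d r k →
             n + d r k + r k ≡ d r k * r k → ¬ Gen (suc k) r n
gluing-gap {k} {r} coprime 0<D n+D+R≡D*R n∈ with Gen-suc⁻ {k} {r} n∈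
... | s , v , s∈ , refl = <-irrefl refl (begin-strict
    D * R               ≤⟨ *-monoˡ-≤ R (∣⇒≤ D∣1+v) ⟩
    suc v * R           ≡⟨ +-comm R (v * R) ⟩
    v * R + R           ≤⟨ +-monoˡ-≤ R (m≤n+m (v * R) s) ⟩
    s + v * R + R       <⟨ +-monoˡ-< R (m<m+n (s + v * R) 0<D) ⟩
    s + v * R + D + R   ≡⟨ n+D+R≡D*R ⟩
    D * R               ∎)
  where
  open ≤-Reasoning
  D R : ℕ
  D = d r k
  R = r k
  regroup : ∀ s v D R → s + v * R + D + R ≡ s + (D + suc v * R)
  regroup = solve-∀
  D∣D+[1+v]*R : D ∣ D + suc v * R
  D∣D+[1+v]*R = ∣m+n∣m⇒∣n (subst (D ∣_) (trans (sym n+D+R≡D*R) (regroup s v D R)) (∣m⇒∣m*n R ∣-refl))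
                          (Gen⇒d∣ {k} {r} s∈)
  D∣1+v : D ∣ suc v
  D∣1+v = coprime-divisor (gcd≡1⇒coprime coprime)
            (subst (D ∣_) (*-comm (suc v) R) (∣m+n∣m⇒∣n D∣D+[1+v]*R ∣-refl))

Free⇒MinGenNS : ∀ {h r} → Free h r → MinGenNS (suc h) r
Free⇒MinGenNS {zero}  = proj₁
Free⇒MinGenNS {suc h} = proj₁

-- Γ is the gluing of D·Γₕ and ⟨R⟩, with D = d_{h+1}, R = r_{h+1} and Γₕ = ⟨r′₀,…,r′ₕ⟩.
module Gluing {h : ℕ} {r : ℕ → ℕ} (free : Free (suc h) r) where

  D R : ℕ
  D = d r (suc h)
  R = r (suc h)

  r′ : ℕ → ℕ
  r′ i = divBy (r i) D

  minimal : MinGenNS (suc (suc h)) r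
  minimal = proj₁ free

  free′ : Free h r′
  free′ = proj₂ (proj₂ free)

  coprime : gcd D R ≡ 1
  coprime = IsNumSemigroup⇒d≡1 {suc (suc h)} {r} (proj₁ minimal)

  D*R∈prefix : Gen (suc h) r (D * R)
  D*R∈prefix = subst (Gen (suc h) r) lcm≡D*R (proj₁ (proj₁ (proj₂ free)))
    where
    lcm≡D*R : lcm D R ≡ D * R
    lcm≡D*R = trans (sym (*-identityˡ (lcm D R)))
                    (trans (cong (_* lcm D R) (sym coprime)) (gcd*lcm D R))

  R≢0 : R ≢ 0
  R≢0 = MinGenNS⇒r≢0 minimal (n<1+n (suc h))

  D≢0 : D ≢ 0
  D≢0 = d≢0 {suc h} {r} (MinGenNS⇒r≢0 minimal (s≤s z≤n)) (s≤s z≤n)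

  D≢1 : D ≢ 1
  D≢1 D≡1 = MinGenNS⇒r∉Gen minimal (n<1+n (suc h))
              (subst (Gen (suc h) r) (trans (cong (_* R) D≡1) (*-identityˡ R)) D*R∈prefix)

  2≤D : 2 ≤ D
  2≤D = ≤∧≢⇒< (n≢0⇒n>0 D≢0) (D≢1 ∘ sym)

  D∤R : ¬ D ∣ R
  D∤R D∣R = D≢1 (∣1⇒≡1 (subst (D ∣_) coprime (gcd-greatest ∣-refl D∣R)))

  r≡D*r′ : ∀ i → i < suc h → r i ≡ D * r′ i
  r≡D*r′ i i<1+h = ∣⇒≡*divBy D≢0 (d∣r (suc h) r i<1+h)

  R∈Γ′ : Gen (suc h) r′ R
  R∈Γ′ = Gen-rescale⁻ D D≢0 r≡D*r′ D*R∈prefix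

e : (ℕ → ℕ) → ℕ → ℕ
e r k = divBy (d r k) (d r (suc k))

e-rescale : ∀ k {r x : ℕ → ℕ} D → D ≢ 0 → (∀ i → i < suc k → r i ≡ D * x i) → e r k ≡ e x k
e-rescale k D D≢0 r≡D*x =
  trans (cong₂ divBy (d-rescale k D (λ i i<k → r≡D*x i (m<n⇒m<1+n i<k))) (d-rescale (suc k) D r≡D*x))
        (divBy-cancelˡ _ _ D≢0)

Free⇒e*r∈prefix : ∀ {h r} → Free h r → ∀ k → 1 ≤ k → k ≤ h → Gen k r (e r k * r k)
Free⇒e*r∈prefix {zero} _ k 1≤k k≤0 = ⊥-elim (<⇒≱ 1≤k k≤0)
Free⇒e*r∈prefix {suc h} {r} free k 1≤k k≤1+h with m≤n⇒m<n∨m≡n k≤1+h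
... | inj₂ refl = subst (Gen (suc h) r) (cong (_* R) (sym e≡D)) D*R∈prefix
  where
  open Gluing free
  e≡D : e r (suc h) ≡ D
  e≡D = trans (cong (divBy D) coprime) (n/1≡n D)
... | inj₁ (s≤s k≤h) =
  subst (Gen k r) D*e′r′≡er (Gen-rescale D (λ i i<k → r≡D*r′ i (<-trans i<k (s≤s k≤h)))
                                        (Free⇒e*r∈prefix free′ k 1≤k k≤h))
  where
  open Gluing free
  e≡e′ : e r k ≡ e r′ k
  e≡e′ = e-rescale k D D≢0 (λ i i<1+k → r≡D*r′ i (≤-trans i<1+k (s≤s k≤h)))
  D*e′r′≡er : D * (e r′ k * r′ k) ≡ e r k * r k
  D*e′r′≡er = begin
    D * (e r′ k * r′ k)  ≡⟨ x∙yz≈y∙xz D (e r′ k) (r′ k) ⟩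
    e r′ k * (D * r′ k)  ≡⟨ cong₂ _*_ (sym e≡e′) (sym (r≡D*r′ k (s≤s k≤h))) ⟩
    e r k * r k          ∎
    where open ≡-Reasoning

Free⇒2≤e×d<d : ∀ {h r} → Free h r → ∀ k → 1 ≤ k → k ≤ h → 2 ≤ e r k × d r (suc k) < d r k
Free⇒2≤e×d<d {h} {r} free k 1≤k k≤h =
  divBy≢1⇒2≤divBy×< (gcd[m,n]∣m (d r k) (r k)) (d≢0 {k} {r} r₀≢0 1≤k) e≢1
  where
  minimal : MinGenNS (suc h) r
  minimal = Free⇒MinGenNS free
  r₀≢0 : r 0 ≢ 0
  r₀≢0 = MinGenNS⇒r≢0 minimal (s≤s z≤n)
  e≢1 : e r k ≢ 1
  e≢1 e≡1 = MinGenNS⇒r∉Gen minimal (s≤s k≤h)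
              (subst (Gen k r) (trans (cong (_* r k) e≡1) (*-identityˡ (r k)))
                     (Free⇒e*r∈prefix free k 1≤k k≤h))

Gen-≥2*min : ∀ {k x n m} → (∀ i → i < k → m ≤ x i) → Gen k x n → n ≢ 0 →
             (∀ j → j < k → n ≢ x j) → 2 * m ≤ n
Gen-≥2*min m≤x n∈ n≢0 n≢x = ≮⇒≥ λ n<2m → case Gen-<2*min m≤x n∈ n<2m of λ where
  (inj₁ n≡0)              → n≢0 n≡0
  (inj₂ (j , j<k , n≡xⱼ)) → n≢x j j<k n≡xⱼ

Free⇒2^h≤r : ∀ {h r} → Free h r → ∀ i → i ≤ h → 2 ^ h ≤ r i
Free⇒2^h≤r {zero} (_ , r₀≡1) zero z≤n = subst (1 ≤_) (sym r₀≡1) ≤-refl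
Free⇒2^h≤r {suc h} {r} free i i≤1+h with m≤n⇒m<n∨m≡n i≤1+h
... | inj₁ (s≤s i≤h) =
  subst (2 ^ suc h ≤_) (sym (r≡D*r′ i (s≤s i≤h))) (*-mono-≤ 2≤D (Free⇒2^h≤r free′ i i≤h))
  where open Gluing free
... | inj₂ refl =
  Gen-≥2*min (λ j j<1+h → Free⇒2^h≤r free′ j (≤-pred j<1+h)) R∈Γ′ R≢0 R≢r′
  where
  open Gluing free
  R≢r′ : ∀ j → j < suc h → R ≢ r′ j
  R≢r′ j j<1+h R≡r′ⱼ =
    MinGenNS⇒r≢*last D minimal j<1+h (trans (r≡D*r′ j j<1+h) (cong (D *_) (sym R≡r′ⱼ)))

1+p≤2*p : ∀ {p} → 1 ≤ p → suc p ≤ 2 * p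
1+p≤2*p {p} 1≤p =
  subst (_≤ 2 * p) (+-comm p 1) (+-monoʳ-≤ p (subst (1 ≤_) (sym (+-identityʳ p)) 1≤p))

2*p≤[D∸1]*[R∸1] : ∀ {p D R} → 1 ≤ p → 2 ≤ D → 2 * p ≤ R → ¬ D ∣ R → 2 * p ≤ (D ∸ 1) * (R ∸ 1)
2*p≤[D∸1]*[R∸1] {D = suc zero} _ (s≤s ()) _ _
2*p≤[D∸1]*[R∸1] {p} {suc (suc zero)} {R} _ _ 2p≤R 2∤R =
  subst (2 * p ≤_) (sym (*-identityˡ (R ∸ 1))) (∸-monoˡ-≤ 1 (≤∧≢⇒< 2p≤R 2p≢R))
  where
  2p≢R : 2 * p ≢ R
  2p≢R 2p≡R = 2∤R (subst (2 ∣_) 2p≡R (m∣m*n p))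
2*p≤[D∸1]*[R∸1] {p} {suc (suc (suc D))} {R} 1≤p _ 2p≤R _ =
  *-mono-≤ {2} {suc (suc D)} (s≤s (s≤s z≤n)) (∸-monoˡ-≤ 1 (≤-trans (1+p≤2*p 1≤p) 2p≤R))

[D∸1]*[R∸1]∸1+D+R≡D*R : ∀ {D R} → 1 ≤ (D ∸ 1) * (R ∸ 1) → (D ∸ 1) * (R ∸ 1) ∸ 1 + D + R ≡ D * R
[D∸1]*[R∸1]∸1+D+R≡D*R {suc a} {zero}  1≤a*0 = ⊥-elim (<⇒≱ 1≤a*0 (≤-reflexive (*-zeroʳ a)))
[D∸1]*[R∸1]∸1+D+R≡D*R {suc a} {suc b} 1≤ab = begin
  a * b ∸ 1 + suc a + suc b    ≡⟨ shuffle (a * b ∸ 1) a b ⟩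
  (a * b ∸ 1 + 1) + a + b + 1  ≡⟨ cong (λ t → t + a + b + 1) (m∸n+n≡m 1≤ab) ⟩
  a * b + a + b + 1            ≡⟨ expand a b ⟩
  suc a * suc b                ∎
  where
  open ≡-Reasoning
  shuffle : ∀ x a b → x + suc a + suc b ≡ (x + 1) + a + b + 1
  shuffle = solve-∀
  expand : ∀ a b → a * b + a + b + 1 ≡ suc a * suc b
  expand = solve-∀

gap≤F⇒D*[R-1]≤[F+1]+[R-1] : ∀ {n D R F} → n + D + R ≡ D * R → ℤ.+ n ℤ.≤ F →
                         ℤ.+ D ℤ.* (ℤ.+ R ℤ.- ℤ.1ℤ) ℤ.≤ (F ℤ.+ ℤ.1ℤ) ℤ.+ (ℤ.+ R ℤ.- ℤ.1ℤ)
gap≤F⇒D*[R-1]≤[F+1]+[R-1] {n} {D} {R} {F} n+D+R≡D*R n≤F =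
  subst₂ ℤ._≤_ (sym lhs) (sym (rhs F (ℤ.+ R))) (ℤP.+-monoˡ-≤ (ℤ.+ R) n≤F)
  where
  open ≡-Reasoning
  expand : ∀ D R → D ℤ.* (R ℤ.- ℤ.1ℤ) ≡ D ℤ.* R ℤ.- D
  expand = ℤR.solve-∀
  cancel : ∀ n D R → n ℤ.+ D ℤ.+ R ℤ.- D ≡ n ℤ.+ R
  cancel = ℤR.solve-∀
  rhs : ∀ F R → (F ℤ.+ ℤ.1ℤ) ℤ.+ (R ℤ.- ℤ.1ℤ) ≡ F ℤ.+ R
  rhs = ℤR.solve-∀
  lhs : ℤ.+ D ℤ.* (ℤ.+ R ℤ.- ℤ.1ℤ) ≡ ℤ.+ n ℤ.+ ℤ.+ R
  lhs = begin
    ℤ.+ D ℤ.* (ℤ.+ R ℤ.- ℤ.1ℤ)         ≡⟨ expand (ℤ.+ D) (ℤ.+ R) ⟩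
    ℤ.+ D ℤ.* ℤ.+ R ℤ.- ℤ.+ D          ≡⟨ cong (ℤ._- ℤ.+ D) (sym (ℤP.pos-* D R)) ⟩
    ℤ.+ (D * R) ℤ.- ℤ.+ D              ≡⟨ cong (λ t → ℤ.+ t ℤ.- ℤ.+ D) (sym n+D+R≡D*R) ⟩
    ℤ.+ (n + D + R) ℤ.- ℤ.+ D          ≡⟨ cong (ℤ._- ℤ.+ D) (trans (ℤP.pos-+ (n + D) R)
                                                              (cong (ℤ._+ ℤ.+ R) (ℤP.pos-+ n D))) ⟩
    ℤ.+ n ℤ.+ ℤ.+ D ℤ.+ ℤ.+ R ℤ.- ℤ.+ D ≡⟨ cancel (ℤ.+ n) (ℤ.+ D) (ℤ.+ R) ⟩
    ℤ.+ n ℤ.+ ℤ.+ R                    ∎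

module _ {h : ℕ} {r : ℕ → ℕ} (free : Free (suc h) r) where
  open Gluing free

  2^[1+h]≤[D∸1]*[R∸1] : 2 ^ suc h ≤ (D ∸ 1) * (R ∸ 1)
  2^[1+h]≤[D∸1]*[R∸1] = 2*p≤[D∸1]*[R∸1] (m^n>0 2 h) 2≤D (Free⇒2^h≤r free (suc h) ≤-refl) D∤R

  D∣F+R×D∤F : ∀ {F} → IsFrobenius (suc (suc h)) r F →
              (ℤ.+ D ℤD.∣ (F ℤ.+ ℤ.+ R)) × ¬ (ℤ.+ D ℤD.∣ F)
  D∣F+R×D∤F {F} isF with Frobenius+r∈prefix {suc h} {r} R≢0 isF
  ... | s , F+R≡s , s∈ = D∣F+R , D∤F
    where
    D∣F+R : ℤ.+ D ℤD.∣ (F ℤ.+ ℤ.+ R)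
    D∣F+R = subst (λ z → D ∣ ℤ.∣ z ∣) (sym F+R≡s) (Gen⇒d∣ {suc h} {r} s∈)
    D∤F : ¬ (ℤ.+ D ℤD.∣ F)
    D∤F D∣F = D∤R (ℤS.∣⇒∣ᵤ {ℤ.+ D} {ℤ.+ R}
                    (ℤS.∣m+n∣m⇒∣n {ℤ.+ D} {F} (ℤS.∣ᵤ⇒∣ {ℤ.+ D} D∣F+R) (ℤS.∣ᵤ⇒∣ {ℤ.+ D} D∣F)))

  D*[R-1]≤[F+1]+[R-1] : ∀ {F} → IsFrobenius (suc (suc h)) r F →
                    ℤ.+ D ℤ.* (ℤ.+ R ℤ.- ℤ.1ℤ) ℤ.≤ (F ℤ.+ ℤ.1ℤ) ℤ.+ (ℤ.+ R ℤ.- ℤ.1ℤ)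
  D*[R-1]≤[F+1]+[R-1] isF = gap≤F⇒D*[R-1]≤[F+1]+[R-1] n+D+R≡D*R (gap≤Frobenius isF n∉Γ)
    where
    n+D+R≡D*R : (D ∸ 1) * (R ∸ 1) ∸ 1 + D + R ≡ D * R
    n+D+R≡D*R = [D∸1]*[R∸1]∸1+D+R≡D*R {D} {R} (≤-trans (m^n>0 2 (suc h)) 2^[1+h]≤[D∸1]*[R∸1])
    n∉Γ : ¬ Gen (suc (suc h)) r ((D ∸ 1) * (R ∸ 1) ∸ 1)
    n∉Γ = gluing-gap coprime (≤-trans (s≤s z≤n) 2≤D) n+D+R≡D*R

lemma3p3 : (h : ℕ) (r : ℕ → ℕ) → 1 ≤ h → Free h r →
    (gcd (d r h) (r h) ≡ 1)
    × (∀ F → IsFrobenius (suc h) r F →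
         (ℤ.+ d r h ℤD.∣ (F ℤ.+ ℤ.+ r h)) × ¬ (ℤ.+ d r h ℤD.∣ F))
    × (∀ k → 1 ≤ k → k ≤ h →
         Gen k r (divBy (d r k) (d r (suc k)) * r k) × 2 ≤ divBy (d r k) (d r (suc k)))
    × ((∀ k → 1 ≤ k → k ≤ h → d r (suc k) < d r k) × d r (suc h) ≡ 1)
    × (∀ F → IsFrobenius (suc h) r F →
         ℤ.+ d r h ℤ.* (ℤ.+ r h ℤ.- ℤ.1ℤ) ℤ.≤ (F ℤ.+ ℤ.1ℤ) ℤ.+ (ℤ.+ r h ℤ.- ℤ.1ℤ))
    × (2 ^ h ≤ (d r h ∸ 1) * (r h ∸ 1))
lemma3p3 zero    r () _
lemma3p3 (suc h) r _  free =
  coprime ,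
  (λ F → D∣F+R×D∤F free) ,
  (λ k 1≤k k≤h → Free⇒e*r∈prefix free k 1≤k k≤h , proj₁ (Free⇒2≤e×d<d free k 1≤k k≤h)) ,
  ((λ k 1≤k k≤h → proj₂ (Free⇒2≤e×d<d free k 1≤k k≤h)) , coprime) ,
  (λ F → D*[R-1]≤[F+1]+[R-1] free) ,
  2^[1+h]≤[D∸1]*[R∸1] free
  where open Gluing free
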